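{- Let $N$ and $v$ be integers with $4\le v<N$, and let $a=\lfloor\frac Nv\rfloor$. Then \[\frac{v-2}{2}\binom{N}{a}+(v-1)\sum_{i=0}^{a-1}\binom{N}{i}<\binom{N}{a+1}.\] -}

module Defs where

open import Data.Nat using (ℕ; zero; suc; _+_)

sumBelow : (ℕ → ℕ) → ℕ → ℕ
sumBelow f zero = 0
sumBelow f (suc k) = sumBelow f k + f k

-- Write c i = N C i. The identity (i+1) c (i+1) = (N−i) c i bounds the lower partial sums,
-- (N+1−2i) Σ_{j<i} c j ≤ i c i, by induction on i. Taking i = a = ⌊N/v⌋, substituting
-- c (a+1) = (N−a)/(a+1) c a and clearing the denominators (a+1)(N+1−2a) reduces the claim to
-- a polynomial inequality in a, w = v−2 and t = N mod v. It holds except at (N, v) = (8, 4)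
-- and (12, 4), where the claim is checked by evaluation.
module Submission where

open import Data.Empty using (⊥-elim)
open import Data.List using ([]; _∷_)
open import Data.Nat using (ℕ; zero; suc; _+_; _*_; _∸_; _≤_; _<_; _/_; NonZero; >-nonZero; z≤n; s≤s; z<s)
open import Data.Nat.Combinatorics using (_C_; nC1≡n; nCk+nC[k+1]≡[n+1]C[k+1])
open import Data.Nat.DivMod using (m≡m%n+[m/n]*n; m/n≤m; m≥n⇒m/n>0)
open import Data.Nat.Properties
open import Data.Nat.Tactic.RingSolver using (solve-∀; solve)
open import Data.Product using (_×_; _,_; ∃-syntax)
open import Data.Sum using (_⊎_; inj₁; inj₂)
open import Function using (_∘_)
open import Relation.Binary.PropositionalEquality
open import Relation.Nullary using (¬_; Dec; yes; no)
open import Relation.Nullary.Decidable using (_×-dec_; _⊎-dec_)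

open import Defs

[1+k]*nC[1+k]+k*nCk≡n*nCk : ∀ n k → suc k * (n C suc k) + k * (n C k) ≡ n * (n C k)
[1+k]*nC[1+k]+k*nCk≡n*nCk n zero = begin
  1 * (n C 1) + 0 * (n C 0) ≡⟨ +-identityʳ (1 * (n C 1)) ⟩
  1 * (n C 1)               ≡⟨ *-identityˡ (n C 1) ⟩
  n C 1                     ≡⟨ nC1≡n n ⟩
  n                         ≡⟨ *-identityʳ n ⟨
  n * (n C 0)               ∎
  where open ≡-Reasoning
[1+k]*nC[1+k]+k*nCk≡n*nCk zero (suc k) = cong₂ _+_ (*-zeroʳ (2 + k)) (*-zeroʳ (suc k))
[1+k]*nC[1+k]+k*nCk≡n*nCk (suc n) (suc k) = begin
  suc (suc k) * (suc n C suc (suc k)) + suc k * (suc n C suc k)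
    ≡⟨ cong₂ (λ x y → suc (suc k) * x + suc k * y) (pascal (suc k)) (pascal k) ⟨
  suc (suc k) * (c₁ + c₂) + suc k * (c₀ + c₁)
    ≡⟨ regroup k c₀ c₁ c₂ ⟩
  (suc (suc k) * c₂ + suc k * c₁) + (suc k * c₁ + k * c₀) + (c₀ + c₁)
    ≡⟨ cong₂ (λ x y → x + y + (c₀ + c₁))
             ([1+k]*nC[1+k]+k*nCk≡n*nCk n (suc k)) ([1+k]*nC[1+k]+k*nCk≡n*nCk n k) ⟩
  n * c₁ + n * c₀ + (c₀ + c₁)
    ≡⟨ collect n c₀ c₁ ⟩
  suc n * (c₀ + c₁)
    ≡⟨ cong (suc n *_) (pascal k) ⟩
  suc n * (suc n C suc k) ∎
  where
  open ≡-Reasoning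
  c₀ = n C k
  c₁ = n C suc k
  c₂ = n C suc (suc k)
  pascal : ∀ j → n C j + n C suc j ≡ suc n C suc j
  pascal = nCk+nC[k+1]≡[n+1]C[k+1] n
  regroup : ∀ k x y z → suc (suc k) * (y + z) + suc k * (x + y)
                      ≡ (suc (suc k) * z + suc k * y) + (suc k * y + k * x) + (x + y)
  regroup = solve-∀
  collect : ∀ n x y → n * y + n * x + (x + y) ≡ suc n * (x + y)
  collect = solve-∀

k≤n⇒nCk>0 : ∀ {n k} → k ≤ n → 0 < n C k
k≤n⇒nCk>0 {n} {zero} _ = z<s
k≤n⇒nCk>0 {suc n} {suc k} (s≤s k≤n) =
  subst (0 <_) (nCk+nC[k+1]≡[n+1]C[k+1] n k) (≤-trans (k≤n⇒nCk>0 k≤n) (m≤m+n _ _))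

n≡k+m⇒[1+k]*nC[1+k]≡m*nCk : ∀ {n} k m → n ≡ k + m → suc k * (n C suc k) ≡ m * (n C k)
n≡k+m⇒[1+k]*nC[1+k]≡m*nCk {n} k m refl = +-cancelʳ-≡ (k * (n C k)) _ _ (begin
  suc k * (n C suc k) + k * (n C k) ≡⟨ [1+k]*nC[1+k]+k*nCk≡n*nCk n k ⟩
  (k + m) * (n C k)                 ≡⟨ *-distribʳ-+ (n C k) k m ⟩
  k * (n C k) + m * (n C k)         ≡⟨ +-comm (k * (n C k)) _ ⟩
  m * (n C k) + k * (n C k)         ∎)
  where open ≡-Reasoning

sumBelow-C-bound : ∀ {n} i d → n ≡ i + (i + d) → sumBelow (n C_) i * suc d ≤ i * (n C i)
sumBelow-C-bound zero d _ = z≤n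
sumBelow-C-bound {n} (suc i) d n≡ = begin
  (S + c) * suc d                   ≡⟨ *-distribʳ-+ (suc d) S c ⟩
  S * suc d + c * suc d             ≤⟨ +-monoˡ-≤ (c * suc d) (*-monoʳ-≤ S (m≤n+m (suc d) 2)) ⟩
  S * (3 + d) + c * suc d           ≤⟨ +-monoˡ-≤ (c * suc d) (sumBelow-C-bound i (2 + d) (trans n≡ (solve (i ∷ d ∷ [])))) ⟩
  i * c + c * suc d                 ≤⟨ m≤m+n _ c ⟩
  i * c + c * suc d + c             ≡⟨ regroup i d c ⟩
  (2 + (i + d)) * c                 ≡⟨ n≡k+m⇒[1+k]*nC[1+k]≡m*nCk i (2 + (i + d)) (trans n≡ (solve (i ∷ d ∷ []))) ⟨
  suc i * (n C suc i)               ∎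
  where
  open ≤-Reasoning
  S = sumBelow (n C_) i
  c = n C i
  regroup : ∀ i d c → i * c + c * suc d + c ≡ (2 + (i + d)) * c
  regroup = solve-∀

clear-denominators : ∀ a w d m {c c′ S} → 0 < c → S * suc d ≤ a * c → suc a * c′ ≡ m * c →
  suc a * suc d * w + 2 * suc w * suc a * a < 2 * suc d * m →
  w * c + 2 * (suc w * S) < 2 * c′
clear-denominators a w d m {c} {c′} {S} c>0 S-bound ratio coefficients =
  *-cancelˡ-< (suc a * suc d) _ _ (begin-strict
    suc a * suc d * (w * c + 2 * (suc w * S))
      ≡⟨ solve (a ∷ w ∷ d ∷ c ∷ S ∷ []) ⟩
    suc a * suc d * w * c + 2 * suc w * suc a * (S * suc d)
      ≤⟨ +-monoʳ-≤ (suc a * suc d * w * c) (*-monoʳ-≤ (2 * suc w * suc a) S-bound) ⟩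
    suc a * suc d * w * c + 2 * suc w * suc a * (a * c)
      ≡⟨ solve (a ∷ w ∷ d ∷ c ∷ []) ⟩
    (suc a * suc d * w + 2 * suc w * suc a * a) * c
      <⟨ *-monoˡ-< c {{>-nonZero c>0}} coefficients ⟩
    2 * suc d * m * c
      ≡⟨ *-assoc (2 * suc d) m c ⟩
    2 * suc d * (m * c)
      ≡⟨ cong (2 * suc d *_) ratio ⟨
    2 * suc d * (suc a * c′)
      ≡⟨ solve (a ∷ d ∷ c′ ∷ []) ⟩
    suc a * suc d * (2 * c′) ∎)
  where open ≤-Reasoning

-- The two cases in which the coefficient inequality below fails; the theorem is then checked directly.
Exceptional : ℕ → ℕ → Set
Exceptional N v = v ≡ 4 × (N ≡ 8 ⊎ N ≡ 12)

exceptional? : ∀ N v → Dec (Exceptional N v)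
exceptional? N v = v ≟ 4 ×-dec (N ≟ 8 ⊎-dec N ≟ 12)

<-from-slack : ∀ {m n} → ∃[ k ] suc m + k ≡ n → m < n
<-from-slack {m} (k , refl) = m≤m+n (suc m) k

-- In each case the slack 2(d+1)m − 1 − LHS, written in a, w, t shifted to the case's base
-- point, has nonnegative coefficients; the excluded triples are where it would be negative.
coefficient-slack : ∀ a w t → 0 < a → 2 ≤ w → 2 + w < t + a * (2 + w) →
  ¬ Exceptional (t + a * (2 + w)) (2 + w) →
  let d = a * w + t ; m = a * suc w + t in
  ∃[ k ] suc (suc a * suc d * w + 2 * suc w * suc a * a) + k ≡ 2 * suc d * m
coefficient-slack _ 1 _ _ (s≤s ()) _ _
coefficient-slack 1 (suc (suc β)) zero _ _ v<N _ = ⊥-elim (<-irrefl (sym (*-identityˡ _)) v<N)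
coefficient-slack 1 (suc (suc β)) (suc s) _ _ _ _ =
  3 + 12 * s + 2 * s * s + 2 * β * s , solve (β ∷ s ∷ [])
coefficient-slack (suc (suc α)) (suc (suc (suc β))) t _ _ _ _ =
  21 * t + 2 * t * t + 9 * β + 5 * β * t + 2 * β * β + 16 * α + 11 * α * t + 17 * α * β
    + 3 * α * β * t + 3 * α * β * β + 7 * α * α + 6 * α * α * β + α * α * β * β
  , solve (α ∷ β ∷ t ∷ [])
coefficient-slack 2 2 zero _ _ _ ¬exc = ⊥-elim (¬exc (refl , inj₁ refl))
coefficient-slack 2 2 (suc s) _ _ _ _ = 11 + 20 * s + 2 * s * s , solve (s ∷ [])
coefficient-slack 3 2 zero _ _ _ ¬exc = ⊥-elim (¬exc (refl , inj₂ refl))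
coefficient-slack 3 2 (suc s) _ _ _ _ = 23 + 28 * s + 2 * s * s , solve (s ∷ [])
coefficient-slack (suc (suc (suc (suc α)))) 2 t _ _ _ _ =
  5 + 32 * t + 2 * t * t + 10 * α + 8 * α * t + 2 * α * α , solve (α ∷ t ∷ [])

bound-at-quotient : ∀ {N w a t} → N ≡ t + a * (2 + w) → 0 < a → a ≤ N → 2 ≤ w → 2 + w < N →
  ¬ Exceptional N (2 + w) →
  w * (N C a) + 2 * (suc w * sumBelow (N C_) a) < 2 * (N C (a + 1))
bound-at-quotient {N} {w} {a} {t} N≡ a>0 a≤N w≥2 v<N ¬exc =
  clear-denominators a w (a * w + t) (a * suc w + t) {S = sumBelow (N C_) a} (k≤n⇒nCk>0 a≤N)
    (sumBelow-C-bound a (a * w + t) (trans N≡ (solve (a ∷ w ∷ t ∷ []))))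
    (subst (λ j → suc a * (N C j) ≡ (a * suc w + t) * (N C a)) (+-comm 1 a)
      (n≡k+m⇒[1+k]*nC[1+k]≡m*nCk a (a * suc w + t) (trans N≡ (solve (a ∷ w ∷ t ∷ [])))))
    (<-from-slack (coefficient-slack a w t a>0 w≥2 (subst (2 + w <_) N≡ v<N)
      (¬exc ∘ subst (λ n → Exceptional n (2 + w)) (sym N≡))))

lemma4p3 : (N v : ℕ) .{{_ : NonZero v}} → 4 ≤ v → v < N →
    (v ∸ 2) * (N C (N / v)) + 2 * ((v ∸ 1) * sumBelow (λ i → N C i) (N / v))
      < 2 * (N C (N / v + 1))
lemma4p3 N v@(suc (suc w)) (s≤s (s≤s w≥2)) v<N with exceptional? N v
... | yes (refl , inj₁ refl) = ≤ᵇ⇒≤ _ _ _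
... | yes (refl , inj₂ refl) = ≤ᵇ⇒≤ _ _ _
... | no ¬exc =
  bound-at-quotient (m≡m%n+[m/n]*n N v) (m≥n⇒m/n>0 (<⇒≤ v<N)) (m/n≤m N v) w≥2 v<N ¬exc
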